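{- Let $\mathcal{C}$ be a category equipped with a stable proper factorisation system, and let $f\colon X\to Y$ be a pathwise embedding in $\mathcal{C}$. Then $f$ is open if and only if $\mathrm{Path}\,f$ is a p-morphism, i.e. $\mathrm{Path}\,f({\uparrow}m)={\uparrow}\,\mathrm{Path}\,f(m)$ for all $m\in\mathrm{Path}\,X$, where ${\uparrow}m=\{m'\in\mathrm{Path}\,X\mid m\le m'\}$ and ${\uparrow}n=\{n'\in\mathrm{Path}\,Y\mid n\le n'\}$.
   Context: All categories are locally small and well-powered. Given morphisms $e,m$, say $e$ has the left lifting property with respect to $m$ if for every commutative square $v\circ e=m\circ u$ there is $d$ with $d\circ e=u$ and $m\circ d=v$. A weak factorisation system on a category is a pair $(\mathcal{Q},\mathcal{M})$ of classes of morphisms such that every morphism factors as $m\circ e$ with $e\in\mathcal{Q}$, $m\in\mathcal{M}$, $\mathcal{Q}$ is exactly the class of morphisms with the left lifting property with respect to all of $\mathcal{M}$, and $\mathcal{M}$ exactly the class with the right lifting property with respect to all of $\mathcal{Q}$. It is proper if morphisms of $\mathcal{Q}$ are epi and those of $\mathcal{M}$ mono; stable if moreover for any $e\in\mathcal{Q}$, $m\in\mathcal{M}$ with common codomain the pullback of $e$ along $m$ exists and lies in $\mathcal{Q}$. Morphisms in $\mathcal{M}$ are embeddings, those in $\mathcal{Q}$ quotients. $\mathrm{Emb}\,X$ is the set of embeddings into $X$ modulo $m\sim n$ iff $m=n\circ i$ for an isomorphism $i$, ordered by $m\le n$ iff $m=n\circ i$ for some morphism $i$. For $f\colon X\to Y$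 and an embedding $m\colon S\to X$, $\exists_f m$ is the embedding part of the (quotient, embedding) factorisation of $f\circ m$. An object $P$ is a path if $\mathrm{Emb}\,P$ is a finite chain. A path embedding is an embedding whose domain is a path; $\mathrm{Path}\,X\subseteq\mathrm{Emb}\,X$ is the subposet of path embeddings and $\mathrm{Path}\,f\colon\mathrm{Path}\,X\to\mathrm{Path}\,Y$ sends $m$ to $\exists_f m$. A morphism $f\colon X\to Y$ is a pathwise embedding if $f\circ m$ is an embedding for every path embedding $m$ into $X$ (so $\mathrm{Path}\,f(m)=f\circ m$). A morphism $f\colon X\to Y$ is open if for every commutative square $f\circ m=n\circ s$ in which $P,Q$ are paths and $s\colon P\to Q$, $m\colon P\to X$, $n\colon Q\to Y$ are embeddings, there exists $d\colon Q\to X$ with $d\circ s=m$ and $f\circ d=n$. -}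

module Defs where

open import Level using (Level; _⊔_) renaming (suc to lsuc)
open import Data.Nat using (ℕ)
open import Data.Fin using (Fin)
open import Data.Product using (Σ; Σ-syntax; _×_; _,_)
open import Data.Sum using (_⊎_)
open import Relation.Binary.PropositionalEquality using (_≡_)
open import Function.Bundles using (_⇔_)

record Category (o h : Level) : Set (lsuc (o ⊔ h)) where
  infixr 9 _∘_
  field
    Obj       : Set o
    Hom       : Obj → Obj → Set h
    id        : ∀ {A} → Hom A A
    _∘_       : ∀ {A B C} → Hom B C → Hom A B → Hom A C
    identityˡ : ∀ {A B} {f : Hom A B} → id ∘ f ≡ f
    identityʳ : ∀ {A B} {f : Hom A B} → f ∘ id ≡ f
    assoc     : ∀ {A B C D} {f : Hom A B} {g : Hom B C} {k : Hom C D} →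
                (k ∘ g) ∘ f ≡ k ∘ (g ∘ f)

module Notions {o h : Level} (C : Category o h) where
  open Category C

  IsIso : ∀ {A B} → Hom A B → Set h
  IsIso {A} {B} i = Σ[ g ∈ Hom B A ] ((g ∘ i ≡ id) × (i ∘ g ≡ id))

  IsEpi : ∀ {A B} → Hom A B → Set (o ⊔ h)
  IsEpi {A} {B} e = ∀ {Z} (g k : Hom B Z) → g ∘ e ≡ k ∘ e → g ≡ k

  IsMono : ∀ {A B} → Hom A B → Set (o ⊔ h)
  IsMono {A} {B} m = ∀ {Z} (g k : Hom Z A) → m ∘ g ≡ m ∘ k → g ≡ k

  LLP : ∀ {A B D E} → Hom A B → Hom D E → Set h
  LLP {A} {B} {D} {E} e m =
    (u : Hom A D) (v : Hom B E) → v ∘ e ≡ m ∘ u →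
    Σ[ d ∈ Hom B D ] ((d ∘ e ≡ u) × (m ∘ d ≡ v))

  module FS {p : Level} (Q M : ∀ {A B} → Hom A B → Set p) where

    record IsWFS : Set (o ⊔ h ⊔ p) where
      field
        factor : ∀ {A B} (f : Hom A B) →
                 Σ[ Z ∈ Obj ] Σ[ e ∈ Hom A Z ] Σ[ m ∈ Hom Z B ]
                   (Q e × M m × (f ≡ m ∘ e))
        Q-is-LLP : ∀ {A B} (e : Hom A B) →
                   Q e ⇔ (∀ {D E} (m : Hom D E) → M m → LLP e m)
        M-is-RLP : ∀ {D E} (m : Hom D E) →
                   M m ⇔ (∀ {A B} (e : Hom A B) → Q e → LLP e m)

    -- pullback of e along m: a square m ∘ π₁ ≡ e ∘ π₂ with the universal
    -- property; π₁ (with codomain dom m) is the pullback of e along m.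
    record Pullback {A B Z : Obj} (e : Hom A Z) (m : Hom B Z) : Set (o ⊔ h) where
      field
        P       : Obj
        π₁      : Hom P B
        π₂      : Hom P A
        commute : m ∘ π₁ ≡ e ∘ π₂
        univ    : ∀ {W} (a : Hom W B) (b : Hom W A) → m ∘ a ≡ e ∘ b →
                  Σ[ u ∈ Hom W P ] ((π₁ ∘ u ≡ a) × (π₂ ∘ u ≡ b) ×
                    (∀ (u' : Hom W P) → π₁ ∘ u' ≡ a → π₂ ∘ u' ≡ b → u' ≡ u))

    record IsStableProperWFS : Set (o ⊔ h ⊔ p) where
      field
        wfs    : IsWFS
        Q-epi  : ∀ {A B} (e : Hom A B) → Q e → IsEpi e
        M-mono : ∀ {A B} (m : Hom A B) → M m → IsMono m
        stable : ∀ {A B Z} (e : Hom A Z) (m : Hom B Z) → Q e → M m →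
                 Σ[ pb ∈ Pullback e m ] Q (Pullback.π₁ pb)

    -- Elements of Emb X (representatives): embeddings into X.
    Emb : Obj → Set (o ⊔ h ⊔ p)
    Emb X = Σ[ S ∈ Obj ] Σ[ m ∈ Hom S X ] M m

    _≤ₕ_ : ∀ {S T X} → Hom S X → Hom T X → Set h
    _≤ₕ_ {S} {T} m n = Σ[ i ∈ Hom S T ] (m ≡ n ∘ i)

    _∼ₕ_ : ∀ {S T X} → Hom S X → Hom T X → Set h
    _∼ₕ_ {S} {T} m n = Σ[ i ∈ Hom S T ] (IsIso i × (m ≡ n ∘ i))

    _≤ₑ_ : ∀ {X} → Emb X → Emb X → Set h
    (_ , m , _) ≤ₑ (_ , n , _) = m ≤ₕ n

    _∼ₑ_ : ∀ {X} → Emb X → Emb X → Set h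
    (_ , m , _) ∼ₑ (_ , n , _) = m ∼ₕ n

    -- P is a path: the poset Emb P (embeddings modulo ∼, ordered by ≤)
    -- is a finite chain: finitely many ∼-classes, and ≤ is total.
    record IsPath (P : Obj) : Set (o ⊔ h ⊔ p) where
      field
        finite : Σ[ n ∈ ℕ ] Σ[ reps ∈ (Fin n → Emb P) ]
                   (∀ (a : Emb P) → Σ[ i ∈ Fin n ] (a ∼ₑ reps i))
        total  : ∀ (a b : Emb P) → (a ≤ₑ b) ⊎ (b ≤ₑ a)

    -- Elements of Path X (representatives): path embeddings into X.
    PathEmb : Obj → Set (o ⊔ h ⊔ p)
    PathEmb X = Σ[ P ∈ Obj ] Σ[ m ∈ Hom P X ] (IsPath P × M m)

    -- n represents ∃_f m: f ∘ m = n ∘ e for some quotient e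
    -- (i.e. n is the embedding part of a (quotient, embedding)
    -- factorisation of f ∘ m).
    IsExImage : ∀ {X Y S T} (f : Hom X Y) (m : Hom S X) (n : Hom T Y) → Set (h ⊔ p)
    IsExImage {S = S} {T = T} f m n = Σ[ e ∈ Hom S T ] (Q e × (f ∘ m ≡ n ∘ e))

    IsPathwiseEmbedding : ∀ {X Y} → Hom X Y → Set (o ⊔ h ⊔ p)
    IsPathwiseEmbedding {X} f =
      ∀ {P} (m : Hom P X) → IsPath P → M m → M (f ∘ m)

    IsOpen : ∀ {X Y} → Hom X Y → Set (o ⊔ h ⊔ p)
    IsOpen {X} {Y} f =
      ∀ {P R} (s : Hom P R) (m : Hom P X) (n : Hom R Y) →
      IsPath P → IsPath R → M s → M m → M n →
      f ∘ m ≡ n ∘ s →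
      Σ[ d ∈ Hom R X ] ((d ∘ s ≡ m) × (f ∘ d ≡ n))

    -- Path f (↑ m) = ↑ (Path f m) for every m ∈ Path X, as subsets of Path Y:
    -- for every n' ∈ Path Y,
    --   [n'] ∈ Path f (↑ m)  ⇔  [n'] ∈ ↑ (Path f m).
    IsPMorphism : ∀ {X Y} → Hom X Y → Set (o ⊔ h ⊔ p)
    IsPMorphism {X} {Y} f =
      ∀ (m : PathEmb X) (n' : PathEmb Y) →
      let (_ , mh , _) = m
          (_ , nh' , _) = n'
      in (Σ[ m' ∈ PathEmb X ] (let (_ , mh' , _) = m' in
            (mh ≤ₕ mh') × IsExImage f mh' nh'))
         ⇔ (Σ[ n ∈ Emb Y ] (let (_ , nh , _) = n in
            IsExImage f mh nh × (nh ≤ₕ nh')))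

-- In a square f ∘ m ≡ n ∘ e with m a path embedding and n an embedding, f ∘ m
-- is an embedding, so e is one too (cancel the mono n). If e is moreover the
-- quotient part of an image of f, it is an isomorphism. Hence "n lies in
-- Path f (↑ m)" means that n is reached by an isomorphic image of some m' ≥ m,
-- and m' composed with the inverse of that isomorphism is a diagonal for the
-- open-map square; conversely a diagonal d exhibits n as the image f ∘ d of
-- d ≥ m.
module Submission where

open import Level using (Level)
open import Function.Bundles using (_⇔_; mk⇔; Equivalence)
open import Data.Product using (Σ; _×_; _,_)
open import Relation.Binary.PropositionalEquality
  using (_≡_; sym; trans; cong; subst; module ≡-Reasoning)
open import Defs

module _ {o h : Level} (C : Category o h) where
  open Category C
  open Notions C
  open ≡-Reasoning

  ∘-congˡ-assoc : ∀ {A B D E} {f : Hom D E} {g : Hom A D} {c : Hom B D} {d : Hom A B} →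
                  g ≡ c ∘ d → f ∘ g ≡ (f ∘ c) ∘ d
  ∘-congˡ-assoc {f = f} g≡cd = trans (cong (f ∘_) g≡cd) (sym assoc)

  module _ {p : Level} (Q M : ∀ {A B} → Hom A B → Set p) where
    open FS Q M

    ≤ₕ-trans : ∀ {S T U X} {m : Hom S X} {n : Hom T X} {k : Hom U X} →
               m ≤ₕ n → n ≤ₕ k → m ≤ₕ k
    ≤ₕ-trans (i , m≡ni) (j , n≡kj) =
      j ∘ i , trans m≡ni (trans (cong (_∘ i) n≡kj) assoc)

    ∘-monoʳ-≤ₕ : ∀ {S T X Y} (f : Hom X Y) {m : Hom S X} {m' : Hom T X} →
                 m ≤ₕ m' → (f ∘ m) ≤ₕ (f ∘ m')
    ∘-monoʳ-≤ₕ f (j , m≡m'j) = j , ∘-congˡ-assoc m≡m'j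

    IsExImage⇒≤ₕ : ∀ {X Y S T} {f : Hom X Y} {m : Hom S X} {n : Hom T Y} →
                   IsExImage f m n → (f ∘ m) ≤ₕ n
    IsExImage⇒≤ₕ (e , _ , fm≡ne) = e , fm≡ne

    diagonal-through-iso : ∀ {X Y P R R'} {f : Hom X Y} {m : Hom P X} {m' : Hom R' X}
                             {n : Hom R Y} {s : Hom P R} {e : Hom R' R} →
                           IsMono n → m ≤ₕ m' → f ∘ m ≡ n ∘ s → f ∘ m' ≡ n ∘ e → IsIso e →
                           Σ (Hom R X) λ d → (d ∘ s ≡ m) × (f ∘ d ≡ n)
    diagonal-through-iso {f = f} {m} {m'} {n} {s} {e} n-mono (j , m≡m'j) fm≡ns fm'≡ne
                         (e⁻¹ , e⁻¹e≡id , ee⁻¹≡id) =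
      m' ∘ e⁻¹
      , (begin
          (m' ∘ e⁻¹) ∘ s        ≡⟨ cong ((m' ∘ e⁻¹) ∘_) s≡ej ⟩
          (m' ∘ e⁻¹) ∘ (e ∘ j)  ≡⟨ assoc ⟩
          m' ∘ (e⁻¹ ∘ (e ∘ j))  ≡⟨ cong (m' ∘_) (sym assoc) ⟩
          m' ∘ ((e⁻¹ ∘ e) ∘ j)  ≡⟨ cong (λ z → m' ∘ (z ∘ j)) e⁻¹e≡id ⟩
          m' ∘ (id ∘ j)         ≡⟨ cong (m' ∘_) identityˡ ⟩
          m' ∘ j                ≡⟨ sym m≡m'j ⟩
          m                     ∎)
      , (begin
          f ∘ (m' ∘ e⁻¹)  ≡⟨ sym assoc ⟩
          (f ∘ m') ∘ e⁻¹  ≡⟨ cong (_∘ e⁻¹) fm'≡ne ⟩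
          (n ∘ e) ∘ e⁻¹   ≡⟨ assoc ⟩
          n ∘ (e ∘ e⁻¹)   ≡⟨ cong (n ∘_) ee⁻¹≡id ⟩
          n ∘ id          ≡⟨ identityʳ ⟩
          n               ∎)
      where
      s≡ej : s ≡ e ∘ j
      s≡ej = n-mono _ _ (begin
        n ∘ s         ≡⟨ sym fm≡ns ⟩
        f ∘ m         ≡⟨ ∘-congˡ-assoc m≡m'j ⟩
        (f ∘ m') ∘ j  ≡⟨ cong (_∘ j) fm'≡ne ⟩
        (n ∘ e) ∘ j   ≡⟨ assoc ⟩
        n ∘ (e ∘ j)   ∎)

    module WFS (wfs : IsWFS) where
      open IsWFS wfs

      id∈Q : ∀ {A} → Q (id {A})
      id∈Q = Equivalence.from (Q-is-LLP id)
        λ _ _ u v v≡mu → u , identityʳ , trans (sym v≡mu) identityʳ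

      Q∩M⇒IsIso : ∀ {A B} {e : Hom A B} → Q e → M e → IsIso e
      Q∩M⇒IsIso {e = e} e∈Q e∈M =
        Equivalence.to (Q-is-LLP e) e∈Q e e∈M id id (trans identityˡ (sym identityʳ))

      IsExImage-∘ : ∀ {X Y S} (f : Hom X Y) (m : Hom S X) → IsExImage f m (f ∘ m)
      IsExImage-∘ f m = id , id∈Q , sym identityʳ

      IsExImage-≡ : ∀ {X Y T} {f : Hom X Y} {d : Hom T X} {n : Hom T Y} →
                    f ∘ d ≡ n → IsExImage f d n
      IsExImage-≡ fd≡n = id , id∈Q , trans fd≡n (sym identityʳ)

      -- Both cancellations lift against g ∘ k and then cancel g (resp. e).
      M-cancelˡ : ∀ {A B D} {g : Hom B D} {k : Hom A B} →
                  IsMono g → M (g ∘ k) → M k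
      M-cancelˡ {g = g} {k} g-mono gk∈M = Equivalence.from (M-is-RLP k)
        λ e e∈Q u v ve≡ku →
          let (d , de≡u , gkd≡gv) = Equivalence.to (M-is-RLP (g ∘ k)) gk∈M e e∈Q u (g ∘ v)
                                      (trans assoc (∘-congˡ-assoc ve≡ku))
          in d , de≡u , g-mono _ _ (trans (sym assoc) gkd≡gv)

      M-cancelˡ-epi : (∀ {A B} (e : Hom A B) → Q e → IsEpi e) →
                      ∀ {A B D} {g : Hom B D} {k : Hom A B} → M (g ∘ k) → M k
      M-cancelˡ-epi Q-epi {g = g} {k} gk∈M = Equivalence.from (M-is-RLP k)
        λ e e∈Q u v ve≡ku →
          let (d , de≡u , gkd≡gv) = Equivalence.to (M-is-RLP (g ∘ k)) gk∈M e e∈Q u (g ∘ v)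
                                      (trans assoc (∘-congˡ-assoc ve≡ku))
          in d , de≡u , Q-epi e e∈Q _ _ (begin
               (k ∘ d) ∘ e  ≡⟨ assoc ⟩
               k ∘ (d ∘ e)  ≡⟨ cong (k ∘_) de≡u ⟩
               k ∘ u        ≡⟨ sym ve≡ku ⟩
               v ∘ e        ∎)

    module _ (sp : IsStableProperWFS) where
      open IsStableProperWFS sp
      open WFS wfs

      module _ {X Y} (f : Hom X Y) (f-pw : IsPathwiseEmbedding f) where

        pathwise-square-∈M : ∀ {P R} {m : Hom P X} {n : Hom R Y} {s : Hom P R} →
                                IsPath P → M m → M n → f ∘ m ≡ n ∘ s → M s
        pathwise-square-∈M P-path m∈M n∈M fm≡ns =
          M-cancelˡ (M-mono _ n∈M) (subst M fm≡ns (f-pw _ P-path m∈M))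

        IsPMorphism⇒IsOpen : IsPMorphism f → IsOpen f
        IsPMorphism⇒IsOpen pmor s m n P-path R-path s∈M m∈M n∈M fm≡ns =
          let ((_ , m' , R'-path , m'∈M) , m≤m' , (e , e∈Q , fm'≡ne)) =
                Equivalence.from (pmor (_ , m , P-path , m∈M) (_ , n , R-path , n∈M))
                  ((_ , f ∘ m , f-pw m P-path m∈M) , IsExImage-∘ f m , (s , fm≡ns))
          in diagonal-through-iso (M-mono n n∈M) m≤m' fm≡ns fm'≡ne
               (Q∩M⇒IsIso e∈Q (pathwise-square-∈M R'-path m'∈M n∈M fm'≡ne))

        IsOpen⇒IsPMorphism : IsOpen f → IsPMorphism f
        IsOpen⇒IsPMorphism f-open (P , m , P-path , m∈M) (R , n' , R-path , n'∈M) =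
          mk⇔ image-of-up⊆up-of-image up-of-image⊆image-of-up
          where
          image-of-up⊆up-of-image :
            Σ (PathEmb X) (λ (_ , m' , _) → (m ≤ₕ m') × IsExImage f m' n') →
            Σ (Emb Y) (λ (_ , n , _) → IsExImage f m n × (n ≤ₕ n'))
          image-of-up⊆up-of-image (_ , m≤m' , m'↦n') =
            (_ , f ∘ m , f-pw m P-path m∈M) , IsExImage-∘ f m ,
            ≤ₕ-trans (∘-monoʳ-≤ₕ f m≤m') (IsExImage⇒≤ₕ m'↦n')

          up-of-image⊆image-of-up :
            Σ (Emb Y) (λ (_ , n , _) → IsExImage f m n × (n ≤ₕ n')) →
            Σ (PathEmb X) (λ (_ , m' , _) → (m ≤ₕ m') × IsExImage f m' n')
          up-of-image⊆image-of-up (_ , m↦n , n≤n') =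
            let (s , fm≡n's) = ≤ₕ-trans (IsExImage⇒≤ₕ m↦n) n≤n'
                (d , ds≡m , fd≡n') = f-open s m n' P-path R-path
                  (pathwise-square-∈M P-path m∈M n'∈M fm≡n's) m∈M n'∈M fm≡n's
            in (R , d , R-path , M-cancelˡ-epi Q-epi {g = f} (subst M (sym fd≡n') n'∈M))
             , (s , sym ds≡m) , IsExImage-≡ fd≡n'

proposition4p2 : ∀ {o h p : Level} (C : Category o h) →
    let open Category C
        open Notions C
    in (Q M : ∀ {A B} → Hom A B → Set p) →
    let open FS Q M
    in IsStableProperWFS → ∀ {X Y} (f : Hom X Y) →
    IsPathwiseEmbedding f → (IsOpen f ⇔ IsPMorphism f)
proposition4p2 C Q M sp f f-pw =
  mk⇔ (IsOpen⇒IsPMorphism C Q M sp f f-pw) (IsPMorphism⇒IsOpen C Q M sp f f-pw)
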